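{- Let $n>4$, let $A$ be a diminishable pair-set in $Q_n$, let $i\in[n]$ with $\sigma_i(A)=(n_0,n_1)$, and if $|A|=n$ assume that $i$ is separating for $A$. Then: (1) If either $|A|=n-1$ and $n_1=0$, or $|A|=n$ and $n_1=1$, then the existence of some $\gamma\in\mathrm{enc}(\rho_{i=1}(\bigcup A))$ implies that either $|A|=n-1$ and $n_0=0$, or $|A|=n$ and $n_0\le 1$. (2) There are at most two vertices $\gamma\in V_n$ such that $\rho_{i=\gamma(i)}(\gamma)\in\mathrm{enc}(\rho_{i=\gamma(i)}(\bigcup A))$. (3) If $\gamma,\gamma'\in V_n$ are distinct with $\rho_{i=\gamma(i)}(\gamma)\in\mathrm{enc}(\rho_{i=\gamma(i)}(\bigcup A))$ and $\rho_{i=\gamma'(i)}(\gamma')\in\mathrm{enc}(\rho_{i=\gamma'(i)}(\bigcup A))$, then $|A|\ge n-1$ and $\chi(\gamma)\ne\chi(\gamma')$; moreover, if $\gamma(i)=\gamma'(i)$ then either $|A|=n-1$ and $n_{\gamma(i)}=n-1$, or $|A|=n$ and $n_{\gamma(i)}\ge n-1$; and if $\gamma(i)\ne\gamma'(i)$ then either $|A|=n-1$ and $n_0=n_1=0$, or $|A|=n$ and $n_0,n_1\le 1$.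
   Context: $[n]=\{0,\dots,n-1\}$, $V_n=\{0,1\}^n$ with coordinates $\alpha(j)$; $Q_n$ is the hypercube on $V_n$ (adjacent iff differing in exactly one coordinate). Parity $\chi(\alpha)=(-1)^{\sum_j\alpha(j)}$. A pair is a multiset $\{\alpha,\beta\}$ of elements of $V_n$; odd if $\chi(\alpha)\ne\chi(\beta)$; edge-pair if an edge of $Q_n$. A pair-set is a set $A$ of pairwise disjoint pairs, some pair (if $A\neq\emptyset$) having distinct elements; $\bigcup A$ is the set of vertices in its pairs; odd if all pairs odd. A vertex is encompassed by $X$ if all its neighbours lie in $X$; $\mathrm{enc}(X)$ is the set of vertices not in $X$ encompassed by $X$ (for $X\subseteq V_{n-1}$ this is taken in $Q_{n-1}$), and $\mathrm{enc}(A)=\mathrm{enc}(\bigcup A)$. For $\alpha$ with $\alpha(i)=k$, $\rho_{i=k}(\alpha)\in V_{n-1}$ is obtained by deleting coordinate $i$; for $X\subseteq V_n$, $\rho_{i=k}(X)=\{\rho_{i=k}(\alpha):\alpha\in X,\ \alpha(i)=k\}$. $\sigma_i(A)=(n_0,n_1)$, $n_k$ = number of pairs $\{\alpha,\beta\}\in A$ with $\alpha(i)=\beta(i)=k$. An odd pair-set $A$ in $Q_n$ is diminishable if either (a) $|A|\le n-1$ and, if $n=4$, $A$ contains an edge-pair or no $X\supseteq\bigcup A$ induces a copy of $Q_3$ in $Q_4$; or (b) $|A|=n\ne4$, $A$ has at least two edge-pairs and $\mathrm{enc}(A)=\emptyset$. For diminishable $A$ with $|A|=n$, $i$ is separating if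 there are edge-pairs $\{\alpha,\beta\},\{\alpha',\beta'\}\in A$ with $\alpha(i)=\beta(i)\ne\alpha'(i)=\beta'(i)$. -}

module Defs where

open import Data.Bool using (Bool; true; false; _xor_; if_then_else_)
open import Data.Nat using (ℕ; zero; suc; _+_; _≤_; _<_)
open import Data.Fin using (Fin)
open import Data.Vec using (Vec; []; _∷_; lookup; removeAt)
open import Data.List using (List; []; _∷_; length)
open import Data.List.Relation.Unary.Any using (Any)
open import Data.List.Relation.Unary.AllPairs using (AllPairs)
open import Data.List.Membership.Propositional using (_∈_)
open import Data.Product using (Σ; ∃; _×_; _,_; proj₁; proj₂)
open import Data.Sum using (_⊎_)
open import Relation.Nullary using (¬_; yes; no)
open import Relation.Binary.PropositionalEquality using (_≡_; _≢_)
open import Data.Bool.Properties using () renaming (_≟_ to _≟B_)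

-- Vertices of Q_n : V_n = {0,1}^n, coordinate 0 = false, 1 = true.
Vertex : ℕ → Set
Vertex n = Vec Bool n

dist : ∀ {n} → Vertex n → Vertex n → ℕ
dist [] [] = 0
dist (a ∷ α) (b ∷ β) with a ≟B b
... | yes _ = dist α β
... | no  _ = suc (dist α β)

Adjacent : ∀ {n} → Vertex n → Vertex n → Set
Adjacent α β = dist α β ≡ 1

-- parity chi(α): true iff the number of ones is odd (chi = -1)
χ : ∀ {n} → Vertex n → Bool
χ [] = false
χ (a ∷ α) = a xor χ α

-- A pair {α,β} (a 2-element multiset) represented by an ordered pair;
-- all notions below are symmetric in the two components.
Pair : ℕ → Set
Pair n = Vertex n × Vertex n

OddPair : ∀ {n} → Pair n → Set
OddPair (α , β) = χ α ≢ χ β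

EdgePair : ∀ {n} → Pair n → Set
EdgePair (α , β) = Adjacent α β

_∈P_ : ∀ {n} → Vertex n → Pair n → Set
v ∈P (α , β) = v ≡ α ⊎ v ≡ β

DisjointPairs : ∀ {n} → Pair n → Pair n → Set
DisjointPairs p q = ∀ v → v ∈P p → ¬ (v ∈P q)

-- A finite set of pairs is represented by a list; pairs at distinct
-- positions are required to be disjoint, so |A| = length A.
PairList : ℕ → Set
PairList n = List (Pair n)

IsPairSet : ∀ {n} → PairList n → Set
IsPairSet A = AllPairs DisjointPairs A
            × (A ≢ [] → Any (λ p → proj₁ p ≢ proj₂ p) A)

IsOddPairSet : ∀ {n} → PairList n → Set
IsOddPairSet A = IsPairSet A × (∀ p → p ∈ A → OddPair p)

⋃ : ∀ {n} → PairList n → Vertex n → Set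
⋃ A v = Any (v ∈P_) A

Enc : ∀ {n} → (Vertex n → Set) → Vertex n → Set
Enc X γ = ¬ X γ × (∀ δ → Adjacent γ δ → X δ)

ρ : ∀ {n} → Fin (suc n) → Bool → (Vertex (suc n) → Set) → Vertex n → Set
ρ i k X δ = ∃ λ α → X α × lookup α i ≡ k × removeAt α i ≡ δ

-- n_k of σ_i(A): number of pairs {α,β} ∈ A with α(i) = β(i) = k
σ : ∀ {n} → Fin n → Bool → PairList n → ℕ
σ i k [] = 0
σ i k ((α , β) ∷ A) with lookup α i ≟B k | lookup β i ≟B k
... | yes _ | yes _ = suc (σ i k A)
... | _     | _     = σ i k A

edgeCount : ∀ {n} → PairList n → ℕ
edgeCount [] = 0
edgeCount ((α , β) ∷ A) with dist α β Data.Nat.≟ 1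
... | yes _ = suc (edgeCount A)
... | no  _ = edgeCount A

IsInducedQ3 : ∀ {n} → (Vertex 3 → Vertex n) → Set
IsInducedQ3 f = (∀ a b → f a ≡ f b → a ≡ b)
              × (∀ a b → Adjacent a b → Adjacent (f a) (f b))
              × (∀ a b → Adjacent (f a) (f b) → Adjacent a b)

-- "some X ⊇ ⋃A induces a copy of Q_3" (X = image of f)
SomeQ3Contains : ∀ {n} → PairList n → Set
SomeQ3Contains {n} A = Σ (Vertex 3 → Vertex n) λ f →
  IsInducedQ3 f × (∀ v → ⋃ A v → ∃ λ a → f a ≡ v)

Diminishable : ∀ {n} → PairList n → Set
Diminishable {n} A = IsOddPairSet A ×
  ( (suc (length A) ≤ n
      × (n ≡ 4 → (Any EdgePair A ⊎ ¬ SomeQ3Contains A)))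
  ⊎ (length A ≡ n × n ≢ 4 × 2 ≤ edgeCount A
      × (∀ γ → ¬ Enc (⋃ A) γ)) )

Separating : ∀ {n} → PairList n → Fin n → Set
Separating A i = ∃ λ p → ∃ λ q → p ∈ A × q ∈ A × EdgePair p × EdgePair q
  × lookup (proj₁ p) i ≡ lookup (proj₂ p) i
  × lookup (proj₁ q) i ≡ lookup (proj₂ q) i
  × lookup (proj₁ p) i ≢ lookup (proj₁ q) i

EncAt : ∀ {n} → PairList (suc n) → Fin (suc n) → Vertex (suc n) → Set
EncAt A i γ = Enc (ρ i (lookup γ i) (⋃ A)) (removeAt γ i)

-- An odd pair has exactly one member of each parity. If ρ_{i=s}(γ) is encompassed by the
-- slice s of ⋃A, its m neighbours in Q_m lift to m vertices of ⋃A of parity ¬χ(γ) in slice s,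
-- hence to m distinct pairs of A whose member of that parity lies in slice s. As |A| ≤ m + 1,
-- two such vertices γ ≠ γ′ cannot have equal parity: in different slices they would need 2m
-- pairs, in the same slice 2m − 2, because two distinct vertices of Q_m have at most two common
-- neighbours. So encompassed vertices have pairwise distinct parities, there are at most two of
-- them, and the bounds on σ_i(A) follow by counting the pairs of A by slice and parity.
module Submission where

open import Defs
open import Data.Bool using (Bool; true; false; not; _xor_; if_then_else_)
open import Data.Bool.Properties
  using (not-involutive; not-injective; not-¬; ¬-not; not-distribˡ-xor; not-distribʳ-xor;
         xor-comm; xor-assoc)
  renaming (_≟_ to _≟ᵇ_)
open import Data.Nat using (ℕ; suc; _+_; _≤_; _<_; z≤n; s≤s)
open import Data.Nat.Properties
  using (≤-refl; ≤-trans; ≤-reflexive; <⇒≤; ≤⇒≯; ≤-antisym; ≤-pred; m≤n⇒m<n∨m≡n; n≤0⇒n≡0;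
         m≤m+n; m≤n+m; +-suc; +-comm; +-mono-≤; +-monoʳ-≤; +-monoˡ-≤; +-cancelʳ-≤; +-cancelˡ-≤;
         +-commutativeSemigroup; module ≤-Reasoning)
open import Algebra.Properties.CommutativeSemigroup +-commutativeSemigroup
  using (interchange; x∙yz≈y∙xz; xy∙z≈xz∙y)
open import Data.Fin using (Fin; zero; suc)
open import Data.Fin.Properties using (any?) renaming (_≟_ to _≟ᶠ_)
open import Data.Vec using ([]; _∷_; lookup; removeAt; insertAt; updateAt)
open import Data.Vec.Properties
  using (≡-dec; insertAt-removeAt; lookup∘updateAt; lookup∘updateAt′; updateAt-id;
         updateAt-updateAt-local)
open import Data.List using (List; []; _∷_; length; map; filter; allFin; _++_)
open import Data.List.Properties using (length-++; length-map; length-tabulate; length-++-sucʳ)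
open import Data.List.Relation.Unary.Any using (here; there)
open import Data.List.Relation.Unary.All using (_∷_)
import Data.List.Relation.Unary.All as All
open import Data.List.Relation.Unary.AllPairs using (_∷_)
open import Data.List.Relation.Unary.Unique.Propositional using (Unique)
open import Data.List.Relation.Unary.Unique.Propositional.Properties
  using (++⁺; map⁺; filter⁺; allFin⁺)
open import Data.List.Relation.Binary.Subset.Propositional using (_⊆_)
open import Data.List.Membership.Propositional using (_∈_; find)
open import Data.List.Membership.Propositional.Properties
  using (∈-∃++; ∈-++⁻; ∈-++⁺ˡ; ∈-++⁺ʳ; ∈-map⁺; ∈-map⁻; ∈-filter⁺; ∈-filter⁻)
open import Data.Product using (∃; _×_; _,_; proj₁; proj₂)
open import Data.Sum using (_⊎_; inj₁; inj₂; [_,_]′)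
import Data.Sum as Sum
open import Data.Empty using (⊥-elim)
open import Function using (_∘_; id)
open import Relation.Nullary using (¬_; Dec; yes; no; does; contradiction; _×-dec_)
open import Relation.Unary using (Decidable)
open import Relation.Unary.Properties using (∁?)
open import Relation.Binary.Definitions using (DecidableEquality)
open import Relation.Binary.PropositionalEquality
  using (_≡_; _≢_; refl; sym; trans; cong; cong₂; subst; subst₂; module ≡-Reasoning)

AtMostTwo : {X : Set} → (X → Set) → Set
AtMostTwo P = ∀ x y z → P x → P y → P z → x ≡ y ⊎ x ≡ z ⊎ y ≡ z

Bool-atMostTwo : ∀ (a b c : Bool) → a ≡ b ⊎ a ≡ c ⊎ b ≡ c
Bool-atMostTwo false false _     = inj₁ refl
Bool-atMostTwo true  true  _     = inj₁ refl
Bool-atMostTwo false true  false = inj₂ (inj₁ refl)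
Bool-atMostTwo false true  true  = inj₂ (inj₂ refl)
Bool-atMostTwo true  false false = inj₂ (inj₂ refl)
Bool-atMostTwo true  false true  = inj₂ (inj₁ refl)

distinct⇒both : ∀ {P : Bool → Set} {s s′} → s ≢ s′ → P s → P s′ → P false × P true
distinct⇒both {s = false} {false} s≢s′ _  _   = contradiction refl s≢s′
distinct⇒both {s = false} {true}  _    ps ps′ = ps , ps′
distinct⇒both {s = true}  {false} _    ps ps′ = ps′ , ps
distinct⇒both {s = true}  {true}  s≢s′ _  _   = contradiction refl s≢s′

xor-cancelʳ : ∀ {a b} s → a xor s ≡ b xor s → a ≡ b
xor-cancelʳ {false} {false} _ _  = refl
xor-cancelʳ {true}  {true}  _ _  = refl
xor-cancelʳ {false} {true}  _ eq = contradiction eq (not-¬ refl)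
xor-cancelʳ {true}  {false} _ eq = contradiction (sym eq) (not-¬ refl)

module _ {X : Set} where

  atMostTwo-separatedByBool : {P : X → Set} → DecidableEquality X → (f : X → Bool) →
    (∀ {x y} → P x → P y → x ≢ y → f x ≢ f y) → AtMostTwo P
  atMostTwo-separatedByBool _≟_ f separated x y z px py pz with x ≟ y | x ≟ z | y ≟ z
  ... | yes x≡y | _       | _       = inj₁ x≡y
  ... | no _    | yes x≡z | _       = inj₂ (inj₁ x≡z)
  ... | no _    | no _    | yes y≡z = inj₂ (inj₂ y≡z)
  ... | no x≢y  | no x≢z  | no y≢z  = ⊥-elim
    ([ separated px py x≢y , [ separated px pz x≢z , separated py pz y≢z ]′ ]′
       (Bool-atMostTwo (f x) (f y) (f z)))

  unique-atMostTwo⇒length≤2 : {xs : List X} → Unique xs → AtMostTwo (_∈ xs) → length xs ≤ 2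
  unique-atMostTwo⇒length≤2 {[]}              _ _ = z≤n
  unique-atMostTwo⇒length≤2 {_ ∷ []}          _ _ = s≤s z≤n
  unique-atMostTwo⇒length≤2 {_ ∷ _ ∷ []}      _ _ = s≤s (s≤s z≤n)
  unique-atMostTwo⇒length≤2 {x ∷ y ∷ z ∷ _} ((x≢y ∷ x≢z ∷ _) ∷ (y≢z ∷ _) ∷ _) atMostTwo =
    ⊥-elim ([ x≢y , [ x≢z , y≢z ]′ ]′
      (atMostTwo x y z (here refl) (there (here refl)) (there (there (here refl)))))

  length-mono-unique : {xs ys : List X} → Unique xs → xs ⊆ ys → length xs ≤ length ys
  length-mono-unique {[]} _ _ = z≤n
  length-mono-unique {x ∷ xs} (x∉xs ∷ unique) xs⊆ys with ∈-∃++ (xs⊆ys (here refl))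
  ... | ys₁ , ys₂ , refl = ≤-trans (s≤s (length-mono-unique unique xs⊆ys₁ys₂))
                                   (≤-reflexive (sym (length-++-sucʳ ys₁ x ys₂)))
    where
    xs⊆ys₁ys₂ : xs ⊆ ys₁ ++ ys₂
    xs⊆ys₁ys₂ {y} y∈xs with ∈-++⁻ ys₁ (xs⊆ys (there y∈xs))
    ... | inj₁ y∈ys₁         = ∈-++⁺ˡ y∈ys₁
    ... | inj₂ (here y≡x)    = contradiction (sym y≡x) (All.lookup x∉xs y∈xs)
    ... | inj₂ (there y∈ys₂) = ∈-++⁺ʳ ys₁ y∈ys₂

  length-filter-∁ : ∀ {P : X → Set} (P? : Decidable P) xs →
    length (filter P? xs) + length (filter (∁? P?) xs) ≡ length xs
  length-filter-∁ P? []       = refl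
  length-filter-∁ P? (x ∷ xs) with P? x
  ... | yes _ = cong suc (length-filter-∁ P? xs)
  ... | no  _ = trans (+-suc _ _) (cong suc (length-filter-∁ P? xs))

  ∑ : (X → ℕ) → List X → ℕ
  ∑ f []       = 0
  ∑ f (x ∷ xs) = f x + ∑ f xs

  ∑-+ : ∀ (f g : X → ℕ) xs → ∑ (λ x → f x + g x) xs ≡ ∑ f xs + ∑ g xs
  ∑-+ f g []       = refl
  ∑-+ f g (x ∷ xs) =
    trans (cong (f x + g x +_) (∑-+ f g xs)) (interchange (f x) (g x) (∑ f xs) (∑ g xs))

  ∑-cong : ∀ {f g : X → ℕ} → (∀ x → f x ≡ g x) → ∀ xs → ∑ f xs ≡ ∑ g xs
  ∑-cong f≗g []       = refl
  ∑-cong f≗g (x ∷ xs) = cong₂ _+_ (f≗g x) (∑-cong f≗g xs)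

  ∑-mono : ∀ {f g : X → ℕ} → (∀ x → f x ≤ g x) → ∀ xs → ∑ f xs ≤ ∑ g xs
  ∑-mono f≤g []       = z≤n
  ∑-mono f≤g (x ∷ xs) = +-mono-≤ (f≤g x) (∑-mono f≤g xs)

  ∑-1 : ∀ xs → ∑ (λ _ → 1) xs ≡ length xs
  ∑-1 []       = refl
  ∑-1 (x ∷ xs) = cong suc (∑-1 xs)

  ∈⇒≤∑ : ∀ {f : X → ℕ} {x xs} → x ∈ xs → f x ≤ ∑ f xs
  ∈⇒≤∑ (here refl)  = m≤m+n _ _
  ∈⇒≤∑ (there x∈xs) = ≤-trans (∈⇒≤∑ x∈xs) (m≤n+m _ _)

𝟙 : {P : Set} → Dec P → ℕ
𝟙 d = if does d then 1 else 0

𝟙-holds : {P : Set} (p? : Dec P) → P → 𝟙 p? ≡ 1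
𝟙-holds (yes _) _ = refl
𝟙-holds (no ¬p) p = contradiction p ¬p

𝟙-×-decˡ : {P Q : Set} (p? : Dec P) (q? : Dec Q) → 𝟙 (p? ×-dec q?) ≤ 𝟙 p?
𝟙-×-decˡ p? q? with does p? | does q?
... | true  | true  = ≤-refl
... | true  | false = z≤n
... | false | _     = z≤n

𝟙-×-decʳ : {P Q : Set} (p? : Dec P) (q? : Dec Q) → 𝟙 (p? ×-dec q?) ≤ 𝟙 q?
𝟙-×-decʳ p? q? with does p? | does q?
... | true  | true  = ≤-refl
... | true  | false = z≤n
... | false | _     = z≤n

∑-𝟙 : ∀ {X : Set} {P : X → Set} (P? : Decidable P) xs → ∑ (𝟙 ∘ P?) xs ≡ length (filter P? xs)
∑-𝟙 P? []       = refl
∑-𝟙 P? (x ∷ xs) with P? x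
... | yes _ = cong suc (∑-𝟙 P? xs)
... | no  _ = ∑-𝟙 P? xs

𝟙-complement : ∀ x s → 𝟙 (x ≟ᵇ s) + 𝟙 (x ≟ᵇ not s) ≡ 1
𝟙-complement false false = refl
𝟙-complement false true  = refl
𝟙-complement true  false = refl
𝟙-complement true  true  = refl

-- Inclusion–exclusion for a pair with coordinates x, y: both, exactly one or neither equal s.
𝟙-pair : ∀ x y s → 𝟙 (x ≟ᵇ s) + 𝟙 (y ≟ᵇ s) + 𝟙 ((x ≟ᵇ not s) ×-dec (y ≟ᵇ not s))
                 ≡ 1 + 𝟙 ((x ≟ᵇ s) ×-dec (y ≟ᵇ s))
𝟙-pair false false false = refl
𝟙-pair false false true  = refl
𝟙-pair false true  false = refl
𝟙-pair false true  true  = refl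
𝟙-pair true  false false = refl
𝟙-pair true  false true  = refl
𝟙-pair true  true  false = refl
𝟙-pair true  true  true  = refl

cancel-doubled : ∀ {m a ℓ x} → m + m + a ≤ ℓ + x → ℓ ≤ m + a → m ≤ x
cancel-doubled {m} {a} {ℓ} {x} bound ℓ≤m+a = +-cancelˡ-≤ (m + a) m x (begin
  m + a + m ≡⟨ xy∙z≈xz∙y m a m ⟩
  m + m + a ≤⟨ bound ⟩
  ℓ + x     ≤⟨ +-monoˡ-≤ x ℓ≤m+a ⟩
  m + a + x ∎)
  where open ≤-Reasoning

module _ {n : ℕ} where

  toggle : Fin n → Vertex n → Vertex n
  toggle j v = updateAt v j not

  toggles : Vertex n → List (Fin n) → List (Vertex n)
  toggles δ = map (λ k → toggle k δ)

  neighbours : Vertex n → List (Vertex n)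
  neighbours δ = toggles δ (allFin n)

  Neighbour : Vertex n → Vertex n → Set
  Neighbour δ v = ∃ λ j → v ≡ toggle j δ

  toggles-neighbour : ∀ {δ ks v} → v ∈ toggles δ ks → Neighbour δ v
  toggles-neighbour {δ} v∈ = let j , _ , v≡ = ∈-map⁻ (λ k → toggle k δ) v∈ in j , v≡

  length-neighbours : ∀ δ → length (neighbours δ) ≡ n
  length-neighbours δ = trans (length-map _ (allFin n)) (length-tabulate id)

  toggle-involutive : ∀ j (v : Vertex n) → toggle j (toggle j v) ≡ v
  toggle-involutive j v = trans (updateAt-updateAt-local j v (not-involutive _)) (updateAt-id j v)

  toggle-injectiveʳ : ∀ j {u v : Vertex n} → toggle j u ≡ toggle j v → u ≡ v
  toggle-injectiveʳ j {u} {v} eq =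
    trans (sym (toggle-involutive j u)) (trans (cong (toggle j) eq) (toggle-involutive j v))

  lookup-toggle-≢ : ∀ {j l} (v : Vertex n) → l ≢ j → lookup (toggle j v) l ≡ lookup v l
  lookup-toggle-≢ {j} {l} v l≢j = lookup∘updateAt′ l j l≢j v

  toggle-injectiveˡ : ∀ (v : Vertex n) {j k} → toggle j v ≡ toggle k v → j ≡ k
  toggle-injectiveˡ v {j} {k} eq with j ≟ᶠ k
  ... | yes j≡k = j≡k
  ... | no  j≢k = contradiction vₖ≡¬vₖ (not-¬ refl)
    where
    open ≡-Reasoning
    vₖ≡¬vₖ : lookup v k ≡ not (lookup v k)
    vₖ≡¬vₖ = begin
      lookup v k            ≡⟨ sym (lookup-toggle-≢ v (j≢k ∘ sym)) ⟩
      lookup (toggle j v) k ≡⟨ cong (λ u → lookup u k) eq ⟩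
      lookup (toggle k v) k ≡⟨ lookup∘updateAt k v ⟩
      not (lookup v k)      ∎

  toggles-unique : ∀ δ {ks} → Unique ks → Unique (toggles δ ks)
  toggles-unique δ = map⁺ (toggle-injectiveˡ δ)

χ-toggle : ∀ {n} j (v : Vertex n) → χ (toggle j v) ≡ not (χ v)
χ-toggle zero    (x ∷ v) = sym (not-distribˡ-xor x (χ v))
χ-toggle (suc j) (x ∷ v) = trans (cong (x xor_) (χ-toggle j v)) (sym (not-distribʳ-xor x (χ v)))

dist-refl : ∀ {n} (v : Vertex n) → dist v v ≡ 0
dist-refl []      = refl
dist-refl (x ∷ v) with x ≟ᵇ x
... | yes _   = dist-refl v
... | no  x≢x = contradiction refl x≢x

toggle-adjacent : ∀ {n} j (v : Vertex n) → Adjacent v (toggle j v)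
toggle-adjacent zero (x ∷ v) with x ≟ᵇ not x
... | yes x≡¬x = contradiction x≡¬x (not-¬ refl)
... | no  _    = cong suc (dist-refl v)
toggle-adjacent (suc j) (x ∷ v) with x ≟ᵇ x
... | yes _   = toggle-adjacent j v
... | no  x≢x = contradiction refl x≢x

encompassed-neighbour : ∀ {n} {X : Vertex n → Set} {δ v} → Enc X δ → Neighbour δ v →
  X v × χ v ≡ not (χ δ)
encompassed-neighbour {δ = δ} (_ , nbrs) (j , refl) = nbrs _ (toggle-adjacent j δ) , χ-toggle j δ

χ-removeAt : ∀ {m} (α : Vertex (suc m)) i → χ α ≡ χ (removeAt α i) xor lookup α i
χ-removeAt (x ∷ α)     zero    = xor-comm x (χ α)
χ-removeAt (x ∷ y ∷ α) (suc i) = trans (cong (x xor_) (χ-removeAt (y ∷ α) i))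
  (sym (xor-assoc x (χ (removeAt (y ∷ α) i)) (lookup (y ∷ α) i)))

removeAt-injective : ∀ {m} {α β : Vertex (suc m)} i →
  lookup α i ≡ lookup β i → removeAt α i ≡ removeAt β i → α ≡ β
removeAt-injective {α = α} {β} i αᵢ≡βᵢ α↓≡β↓ = trans (sym (insertAt-removeAt α i))
  (trans (cong₂ (λ v x → insertAt v i x) α↓≡β↓ αᵢ≡βᵢ) (insertAt-removeAt β i))

-- Common neighbours

module _ {n : ℕ} (δ δ′ : Vertex n) where

  CommonAt : Fin n → Set
  CommonAt k = ∃ λ j → toggle j δ ≡ toggle k δ′

  commonAt? : Decidable CommonAt
  commonAt? k = any? (λ j → ≡-dec _≟ᵇ_ (toggle j δ) (toggle k δ′))

  agreeing⇒¬commonAt : ∀ {l} → δ ≢ δ′ → lookup δ l ≡ lookup δ′ l → ¬ CommonAt l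
  agreeing⇒¬commonAt {l} δ≢δ′ agree (j , eq) with j ≟ᶠ l
  ... | yes refl = δ≢δ′ (toggle-injectiveʳ j eq)
  ... | no  j≢l  = contradiction δ′ₗ≡¬δ′ₗ (not-¬ refl)
    where
    open ≡-Reasoning
    δ′ₗ≡¬δ′ₗ : lookup δ′ l ≡ not (lookup δ′ l)
    δ′ₗ≡¬δ′ₗ = begin
      lookup δ′ l            ≡⟨ sym agree ⟩
      lookup δ l             ≡⟨ sym (lookup-toggle-≢ δ (j≢l ∘ sym)) ⟩
      lookup (toggle j δ) l  ≡⟨ cong (λ u → lookup u l) eq ⟩
      lookup (toggle l δ′) l ≡⟨ lookup∘updateAt l δ′ ⟩
      not (lookup δ′ l)      ∎

  common⇒agreeing : ∀ {j k l} → toggle j δ ≡ toggle k δ′ → l ≢ j → l ≢ k →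
    lookup δ l ≡ lookup δ′ l
  common⇒agreeing {j} {k} {l} eq l≢j l≢k = begin
    lookup δ l             ≡⟨ sym (lookup-toggle-≢ δ l≢j) ⟩
    lookup (toggle j δ) l  ≡⟨ cong (λ u → lookup u l) eq ⟩
    lookup (toggle k δ′) l ≡⟨ lookup-toggle-≢ δ′ l≢k ⟩
    lookup δ′ l            ∎
    where open ≡-Reasoning

  commonAt-within : ∀ {j k l} → δ ≢ δ′ → toggle j δ ≡ toggle k δ′ → CommonAt l → l ≡ j ⊎ l ≡ k
  commonAt-within {j} {k} {l} δ≢δ′ eq common with l ≟ᶠ j | l ≟ᶠ k
  ... | yes l≡j | _       = inj₁ l≡j
  ... | no _    | yes l≡k = inj₂ l≡k
  ... | no l≢j  | no l≢k  =
    contradiction common (agreeing⇒¬commonAt δ≢δ′ (common⇒agreeing eq l≢j l≢k))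

  commonAt-atMostTwo : δ ≢ δ′ → AtMostTwo CommonAt
  commonAt-atMostTwo δ≢δ′ x y z (_ , eq) common-y common-z
    with commonAt-within δ≢δ′ eq common-y | commonAt-within δ≢δ′ eq common-z
  ... | inj₂ y≡x | _        = inj₁ (sym y≡x)
  ... | _        | inj₂ z≡x = inj₂ (inj₁ (sym z≡x))
  ... | inj₁ y≡j | inj₁ z≡j = inj₂ (inj₂ (trans y≡j (sym z≡j)))

  common uncommon : List (Fin n)
  common   = filter commonAt? (allFin n)
  uncommon = filter (∁? commonAt?) (allFin n)

  length-common≤2 : δ ≢ δ′ → length common ≤ 2
  length-common≤2 δ≢δ′ = unique-atMostTwo⇒length≤2 (filter⁺ commonAt? (allFin⁺ n))
    λ x y z x∈ y∈ z∈ → commonAt-atMostTwo δ≢δ′ x y z (isCommon x∈) (isCommon y∈) (isCommon z∈)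
    where
    isCommon : ∀ {k} → k ∈ common → CommonAt k
    isCommon = proj₂ ∘ ∈-filter⁻ commonAt? {xs = allFin n}

  neighbourhoods-union : δ ≢ δ′ → ∃ λ W → Unique W × n + n ≤ 2 + length W
    × (∀ {v} → v ∈ W → Neighbour δ v ⊎ Neighbour δ′ v)
  neighbourhoods-union δ≢δ′ = W , unique , size , neighbour
    where
    W = neighbours δ ++ toggles δ′ uncommon

    disjoint : ∀ {v} → ¬ (v ∈ neighbours δ × v ∈ toggles δ′ uncommon)
    disjoint (v∈N , v∈M) with toggles-neighbour v∈N | ∈-map⁻ (λ k → toggle k δ′) v∈M
    ... | j , refl | k , k∈uncommon , eq =
      proj₂ (∈-filter⁻ (∁? commonAt?) {xs = allFin n} k∈uncommon) (j , eq)

    unique : Unique W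
    unique = ++⁺ (toggles-unique δ (allFin⁺ n))
                 (toggles-unique δ′ (filter⁺ (∁? commonAt?) (allFin⁺ n))) disjoint

    length-W : length W ≡ n + length uncommon
    length-W = trans (length-++ (neighbours δ))
                     (cong₂ _+_ (length-neighbours δ) (length-map _ uncommon))

    size : n + n ≤ 2 + length W
    size = begin
      n + n                                 ≡⟨ cong (n +_) (sym common+uncommon) ⟩
      n + (length common + length uncommon) ≤⟨ +-monoʳ-≤ n (+-monoˡ-≤ _ (length-common≤2 δ≢δ′)) ⟩
      n + (2 + length uncommon)             ≡⟨ x∙yz≈y∙xz n 2 _ ⟩
      2 + (n + length uncommon)             ≡⟨ cong (2 +_) (sym length-W) ⟩
      2 + length W                          ∎
      where
      open ≤-Reasoning
      common+uncommon : length common + length uncommon ≡ n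
      common+uncommon = trans (length-filter-∁ commonAt? (allFin n)) (length-tabulate id)

    neighbour : ∀ {v} → v ∈ W → Neighbour δ v ⊎ Neighbour δ′ v
    neighbour v∈W with ∈-++⁻ (neighbours δ) v∈W
    ... | inj₁ v∈N = inj₁ (toggles-neighbour v∈N)
    ... | inj₂ v∈M = inj₂ (toggles-neighbour v∈M)

-- Pairs counted by slice and parity

memberOfParity : ∀ {n} → Bool → Pair n → Vertex n
memberOfParity b (α , β) = if does (χ α ≟ᵇ b) then α else β

memberOfParity-odd : ∀ {n} {p : Pair n} {v} → OddPair p → v ∈P p → memberOfParity (χ v) p ≡ v
memberOfParity-odd {p = α , β} _ (inj₁ refl) with χ α ≟ᵇ χ α
... | yes _     = refl
... | no  χα≢χα = contradiction refl χα≢χα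
memberOfParity-odd {p = α , β} odd (inj₂ refl) with χ α ≟ᵇ χ β
... | yes χα≡χβ = contradiction χα≡χβ odd
... | no  _     = refl

memberOfParity-both : ∀ {n} (f : Vertex n → ℕ) b (p : Pair n) →
  f (memberOfParity b p) + f (memberOfParity (not b) p) ≡ f (proj₁ p) + f (proj₂ p)
memberOfParity-both f b (α , β) with χ α
memberOfParity-both f true  (α , β) | true  = refl
memberOfParity-both f false (α , β) | true  = +-comm (f β) (f α)
memberOfParity-both f true  (α , β) | false = +-comm (f β) (f α)
memberOfParity-both f false (α , β) | false = refl

module _ {n : ℕ} (i : Fin n) where

  -- For odd A, the number of vertices of ⋃A of parity b with i-th coordinate s.
  sliceCount : Bool → Bool → PairList n → ℕ
  sliceCount b s = ∑ (λ p → 𝟙 (lookup (memberOfParity b p) i ≟ᵇ s))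

  bothIn? : (s : Bool) (p : Pair n) → Dec (lookup (proj₁ p) i ≡ s × lookup (proj₂ p) i ≡ s)
  bothIn? s (α , β) = (lookup α i ≟ᵇ s) ×-dec (lookup β i ≟ᵇ s)

  σ≡∑ : ∀ s A → σ i s A ≡ ∑ (𝟙 ∘ bothIn? s) A
  σ≡∑ s []            = refl
  σ≡∑ s ((α , β) ∷ A) with lookup α i ≟ᵇ s | lookup β i ≟ᵇ s
  ... | yes _ | yes _ = cong suc (σ≡∑ s A)
  ... | yes _ | no  _ = σ≡∑ s A
  ... | no  _ | _     = σ≡∑ s A

  sliceCount-complement : ∀ b s A → sliceCount b s A + sliceCount b (not s) A ≡ length A
  sliceCount-complement b s A = begin
    sliceCount b s A + sliceCount b (not s) A
      ≡⟨ sym (∑-+ _ _ A) ⟩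
    ∑ (λ p → 𝟙 (coordinate p ≟ᵇ s) + 𝟙 (coordinate p ≟ᵇ not s)) A
      ≡⟨ ∑-cong (λ p → 𝟙-complement (coordinate p) s) A ⟩
    ∑ (λ _ → 1) A
      ≡⟨ ∑-1 A ⟩
    length A ∎
    where
    open ≡-Reasoning
    coordinate : Pair n → Bool
    coordinate p = lookup (memberOfParity b p) i

  sliceCount≤length : ∀ b s A → sliceCount b s A ≤ length A
  sliceCount≤length b s A = ≤-trans (m≤m+n _ _) (≤-reflexive (sliceCount-complement b s A))

  σ≤sliceCount : ∀ b s A → σ i s A ≤ sliceCount b s A
  σ≤sliceCount b s A = subst (_≤ sliceCount b s A) (sym (σ≡∑ s A)) (∑-mono both≤member A)
    where
    both≤member : ∀ p → 𝟙 (bothIn? s p) ≤ 𝟙 (lookup (memberOfParity b p) i ≟ᵇ s)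
    both≤member (α , β) with χ α ≟ᵇ b
    ... | yes _ = 𝟙-×-decˡ (lookup α i ≟ᵇ s) (lookup β i ≟ᵇ s)
    ... | no  _ = 𝟙-×-decʳ (lookup α i ≟ᵇ s) (lookup β i ≟ᵇ s)

  sliceCount-bothParities : ∀ b s A →
    sliceCount b s A + sliceCount (not b) s A + σ i (not s) A ≡ length A + σ i s A
  sliceCount-bothParities b s A = begin
    sliceCount b s A + sliceCount (not b) s A + σ i (not s) A
      ≡⟨ cong₂ _+_ (sym (∑-+ member-b member-¬b A)) (σ≡∑ (not s) A) ⟩
    ∑ (λ p → member-b p + member-¬b p) A + ∑ (𝟙 ∘ bothIn? (not s)) A
      ≡⟨ sym (∑-+ _ _ A) ⟩
    ∑ (λ p → member-b p + member-¬b p + 𝟙 (bothIn? (not s) p)) A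
      ≡⟨ ∑-cong per-pair A ⟩
    ∑ (λ p → 1 + 𝟙 (bothIn? s p)) A
      ≡⟨ ∑-+ _ _ A ⟩
    ∑ (λ _ → 1) A + ∑ (𝟙 ∘ bothIn? s) A
      ≡⟨ cong₂ _+_ (∑-1 A) (sym (σ≡∑ s A)) ⟩
    length A + σ i s A ∎
    where
    open ≡-Reasoning
    inSlice : Vertex n → ℕ
    inSlice v = 𝟙 (lookup v i ≟ᵇ s)
    member-b member-¬b : Pair n → ℕ
    member-b  p = inSlice (memberOfParity b p)
    member-¬b p = inSlice (memberOfParity (not b) p)
    per-pair : ∀ p → member-b p + member-¬b p + 𝟙 (bothIn? (not s) p) ≡ 1 + 𝟙 (bothIn? s p)
    per-pair (α , β) =
      trans (cong (_+ 𝟙 (bothIn? (not s) (α , β))) (memberOfParity-both inSlice b (α , β)))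
            (𝟙-pair (lookup α i) (lookup β i) s)

  σ-opposite≤ : ∀ {m} t {b s} A → m ≤ sliceCount b s A → length A ≡ t + m → σ i (not s) A ≤ t
  σ-opposite≤ {m} t {b} {s} A m≤count ℓ≡t+m =
    ≤-trans (σ≤sliceCount b (not s) A) (+-cancelʳ-≤ m _ t (begin
      sliceCount b (not s) A + m                ≤⟨ +-monoʳ-≤ _ m≤count ⟩
      sliceCount b (not s) A + sliceCount b s A ≡⟨ +-comm _ (sliceCount b s A) ⟩
      sliceCount b s A + sliceCount b (not s) A ≡⟨ sliceCount-complement b s A ⟩
      length A                                  ≡⟨ ℓ≡t+m ⟩
      t + m                                     ∎))
    where open ≤-Reasoning

  σ-opposite-parities : ∀ {m b s} A → m ≤ sliceCount b s A → m ≤ sliceCount (not b) s A →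
    m + m + σ i (not s) A ≤ length A + σ i s A
  σ-opposite-parities {b = b} {s} A m≤count m≤count′ =
    ≤-trans (+-monoˡ-≤ _ (+-mono-≤ m≤count m≤count′)) (≤-reflexive (sliceCount-bothParities b s A))

  ∈⇒σ-positive : ∀ {s p A} → p ∈ A → lookup (proj₁ p) i ≡ s → lookup (proj₂ p) i ≡ s → 1 ≤ σ i s A
  ∈⇒σ-positive {s} {p} {A} p∈A αᵢ≡s βᵢ≡s = subst (1 ≤_) (sym (σ≡∑ s A))
    (subst (_≤ ∑ (𝟙 ∘ bothIn? s) A) (𝟙-holds (bothIn? s p) (αᵢ≡s , βᵢ≡s)) (∈⇒≤∑ p∈A))

  separating⇒σ-positive : ∀ {A} → Separating A i → ∀ s → 1 ≤ σ i s A
  separating⇒σ-positive ((α , β) , (α′ , β′) , p∈A , q∈A , _ , _ , αᵢ≡βᵢ , α′ᵢ≡β′ᵢ , αᵢ≢α′ᵢ) s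
    with lookup α i ≟ᵇ s
  ... | yes αᵢ≡s = ∈⇒σ-positive p∈A αᵢ≡s (trans (sym αᵢ≡βᵢ) αᵢ≡s)
  ... | no  αᵢ≢s = ∈⇒σ-positive q∈A α′ᵢ≡s (trans (sym α′ᵢ≡β′ᵢ) α′ᵢ≡s)
    where
    α′ᵢ≡s : lookup α′ i ≡ s
    α′ᵢ≡s = trans (¬-not (αᵢ≢α′ᵢ ∘ sym)) (trans (cong not (¬-not αᵢ≢s)) (not-involutive s))

-- Encompassed vertices of a slice

module _ {m : ℕ} (i : Fin (suc m)) {A : PairList (suc m)} (odd : ∀ p → p ∈ A → OddPair p) where

  -- Each witness lifts to a vertex of ⋃A of parity c xor s in slice s, which is the member of
  -- that parity of its pair; distinct witnesses therefore come from distinct pairs.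
  witnesses≤sliceCount : ∀ {s c} {W : List (Vertex m)} → Unique W →
    (∀ {w} → w ∈ W → ρ i s (⋃ A) w × χ w ≡ c) → length W ≤ sliceCount i (c xor s) s A
  witnesses≤sliceCount {s} {c} {W} unique witness = begin
    length W                               ≤⟨ length-mono-unique unique W⊆ ⟩
    length (map lower (filter inSlice? A)) ≡⟨ length-map lower (filter inSlice? A) ⟩
    length (filter inSlice? A)             ≡⟨ sym (∑-𝟙 inSlice? A) ⟩
    sliceCount i (c xor s) s A             ∎
    where
    open ≤-Reasoning
    inSlice? : Decidable (λ p → lookup (memberOfParity (c xor s) p) i ≡ s)
    inSlice? p = lookup (memberOfParity (c xor s) p) i ≟ᵇ s
    lower : Pair (suc m) → Vertex m
    lower p = removeAt (memberOfParity (c xor s) p) i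
    W⊆ : W ⊆ map lower (filter inSlice? A)
    W⊆ {w} w∈W with witness w∈W
    ... | (α , α∈⋃A , αᵢ≡s , α↓≡w) , χw≡c with find α∈⋃A
    ...   | p , p∈A , α∈p = subst (_∈ map lower (filter inSlice? A)) lower-p≡w
      (∈-map⁺ lower (∈-filter⁺ inSlice? p∈A (trans (cong (λ v → lookup v i) member≡α) αᵢ≡s)))
      where
      χα≡ : χ α ≡ c xor s
      χα≡ = trans (χ-removeAt α i) (cong₂ _xor_ (trans (cong χ α↓≡w) χw≡c) αᵢ≡s)
      member≡α : memberOfParity (c xor s) p ≡ α
      member≡α = subst (λ b → memberOfParity b p ≡ α) χα≡ (memberOfParity-odd (odd p p∈A) α∈p)
      lower-p≡w : lower p ≡ w
      lower-p≡w = trans (cong (λ v → removeAt v i) member≡α) α↓≡w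

  encompassed⇒sliceCount : ∀ {s} {δ : Vertex m} → Enc (ρ i s (⋃ A)) δ →
    m ≤ sliceCount i (not (χ δ) xor s) s A
  encompassed⇒sliceCount {s} {δ} enc = subst (_≤ sliceCount i (not (χ δ) xor s) s A)
    (length-neighbours δ)
    (witnesses≤sliceCount (toggles-unique δ (allFin⁺ m)) (encompassed-neighbour enc ∘ toggles-neighbour))

  encAt⇒sliceCount : ∀ γ → EncAt A i γ → m ≤ sliceCount i (not (χ γ)) (lookup γ i) A
  encAt⇒sliceCount γ enc =
    subst (λ b → m ≤ sliceCount i b (lookup γ i) A) lifted (encompassed⇒sliceCount enc)
    where
    lifted : not (χ (removeAt γ i)) xor lookup γ i ≡ not (χ γ)
    lifted = trans (sym (not-distribˡ-xor (χ (removeAt γ i)) (lookup γ i)))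
                   (cong not (sym (χ-removeAt γ i)))

  encompassedPair⇒length : ∀ {s} {δ δ′ : Vertex m} → δ ≢ δ′ → χ δ ≡ χ δ′ →
    Enc (ρ i s (⋃ A)) δ → Enc (ρ i s (⋃ A)) δ′ → m + m ≤ 2 + length A
  encompassedPair⇒length {s} {δ} {δ′} δ≢δ′ χδ≡χδ′ enc enc′ with neighbourhoods-union δ δ′ δ≢δ′
  ... | W , unique , size , neighbour = ≤-trans size (+-monoʳ-≤ 2
        (≤-trans (witnesses≤sliceCount unique witness) (sliceCount≤length i _ s A)))
    where
    witness : ∀ {w} → w ∈ W → ρ i s (⋃ A) w × χ w ≡ not (χ δ)
    witness w∈W with neighbour w∈W
    ... | inj₁ nδ  = encompassed-neighbour enc nδ
    ... | inj₂ nδ′ with encompassed-neighbour enc′ nδ′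
    ...   | ρw , χw≡ = ρw , trans χw≡ (cong not (sym χδ≡χδ′))

  sameSlice⇒χ-distinct : 4 ≤ m → length A ≤ suc m → ∀ γ γ′ → γ ≢ γ′ →
    lookup γ i ≡ lookup γ′ i → EncAt A i γ → EncAt A i γ′ → χ γ ≢ χ γ′
  sameSlice⇒χ-distinct 4≤m short γ γ′ γ≢γ′ same enc enc′ χγ≡χγ′ = ≤⇒≯ (+-cancelʳ-≤ m m 3
    (≤-trans (encompassedPair⇒length δ≢δ′ χδ≡χδ′ enc enc″) (+-monoʳ-≤ 2 short))) 4≤m
    where
    δ≢δ′ : removeAt γ i ≢ removeAt γ′ i
    δ≢δ′ = γ≢γ′ ∘ removeAt-injective i same
    χδ≡χδ′ : χ (removeAt γ i) ≡ χ (removeAt γ′ i)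
    χδ≡χδ′ = xor-cancelʳ (lookup γ i) (trans (sym (χ-removeAt γ i))
      (trans χγ≡χγ′ (trans (χ-removeAt γ′ i) (cong (χ (removeAt γ′ i) xor_) (sym same)))))
    enc″ : Enc (ρ i (lookup γ i) (⋃ A)) (removeAt γ′ i)
    enc″ = subst (λ s → Enc (ρ i s (⋃ A)) (removeAt γ′ i)) (sym same) enc′

  differentSlices⇒χ-distinct : 2 ≤ m → length A ≤ suc m → ∀ γ γ′ →
    lookup γ i ≢ lookup γ′ i → EncAt A i γ → EncAt A i γ′ → χ γ ≢ χ γ′
  differentSlices⇒χ-distinct 2≤m short γ γ′ different enc enc′ χγ≡χγ′ =
    ≤⇒≯ (+-cancelʳ-≤ m m 1 (≤-trans bothSlices short)) 2≤m
    where
    open ≤-Reasoning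
    s = lookup γ i
    enc″ : m ≤ sliceCount i (not (χ γ)) (not s) A
    enc″ = subst₂ (λ b s′ → m ≤ sliceCount i b s′ A) (cong not (sym χγ≡χγ′)) (¬-not (different ∘ sym))
                  (encAt⇒sliceCount γ′ enc′)
    bothSlices : m + m ≤ length A
    bothSlices = begin
      m + m
        ≤⟨ +-mono-≤ (encAt⇒sliceCount γ enc) enc″ ⟩
      sliceCount i (not (χ γ)) s A + sliceCount i (not (χ γ)) (not s) A
        ≡⟨ sliceCount-complement i _ s A ⟩
      length A ∎

module Encompassed {m : ℕ} (i : Fin (suc m)) {A : PairList (suc m)}
  (odd : ∀ p → p ∈ A → OddPair p) (short : length A ≤ suc m) where

  encAt⇒m≤length : ∀ γ → EncAt A i γ → m ≤ length A
  encAt⇒m≤length γ enc = ≤-trans (encAt⇒sliceCount i odd γ enc) (sliceCount≤length i _ _ A)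

  length-cases : m ≤ length A → length A ≡ m ⊎ length A ≡ suc m
  length-cases m≤ℓ with m≤n⇒m<n∨m≡n short
  ... | inj₁ ℓ<1+m = inj₁ (≤-antisym (≤-pred ℓ<1+m) m≤ℓ)
  ... | inj₂ ℓ≡1+m = inj₂ ℓ≡1+m

  encAt-χ-injective : 4 ≤ m → ∀ γ γ′ → γ ≢ γ′ → EncAt A i γ → EncAt A i γ′ → χ γ ≢ χ γ′
  encAt-χ-injective 4≤m γ γ′ γ≢γ′ enc enc′ with lookup γ i ≟ᵇ lookup γ′ i
  ... | yes same      = sameSlice⇒χ-distinct i odd 4≤m short γ γ′ γ≢γ′ same enc enc′
  ... | no  different =
    differentSlices⇒χ-distinct i odd (≤-trans (s≤s (s≤s z≤n)) 4≤m) short γ γ′ different enc enc′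

  encAt-atMostTwo : 4 ≤ m → AtMostTwo (EncAt A i)
  encAt-atMostTwo 4≤m = atMostTwo-separatedByBool (≡-dec _≟ᵇ_) χ
    λ {γ} {γ′} enc enc′ γ≢γ′ → encAt-χ-injective 4≤m γ γ′ γ≢γ′ enc enc′

  encompassed⇒σ-opposite : ∀ {s δ} → Enc (ρ i s (⋃ A)) δ → length A ≡ m ⊎ length A ≡ suc m →
    (length A ≡ m × σ i (not s) A ≡ 0) ⊎ (length A ≡ suc m × σ i (not s) A ≤ 1)
  encompassed⇒σ-opposite enc (inj₁ ℓ≡m)   =
    inj₁ (ℓ≡m , n≤0⇒n≡0 (σ-opposite≤ i 0 A (encompassed⇒sliceCount i odd enc) ℓ≡m))
  encompassed⇒σ-opposite enc (inj₂ ℓ≡1+m) =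
    inj₂ (ℓ≡1+m , σ-opposite≤ i 1 A (encompassed⇒sliceCount i odd enc) ℓ≡1+m)

  differentSlices⇒σ≤ : ∀ γ γ′ → EncAt A i γ → EncAt A i γ′ → lookup γ i ≢ lookup γ′ i →
    ∀ t → length A ≡ t + m → σ i false A ≤ t × σ i true A ≤ t
  differentSlices⇒σ≤ γ γ′ enc enc′ different t ℓ≡t+m =
    distinct⇒both {λ s → σ i s A ≤ t} (different ∘ not-injective)
      (σ-opposite≤ i t A (encAt⇒sliceCount i odd γ enc) ℓ≡t+m)
      (σ-opposite≤ i t A (encAt⇒sliceCount i odd γ′ enc′) ℓ≡t+m)

  differentSlices⇒σ : ∀ γ γ′ → EncAt A i γ → EncAt A i γ′ → lookup γ i ≢ lookup γ′ i →
    (length A ≡ m × σ i false A ≡ 0 × σ i true A ≡ 0)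
    ⊎ (length A ≡ suc m × σ i false A ≤ 1 × σ i true A ≤ 1)
  differentSlices⇒σ γ γ′ enc enc′ different with length-cases (encAt⇒m≤length γ enc)
  ... | inj₁ ℓ≡m with differentSlices⇒σ≤ γ γ′ enc enc′ different 0 ℓ≡m
  ...   | σ₀≤0 , σ₁≤0 = inj₁ (ℓ≡m , n≤0⇒n≡0 σ₀≤0 , n≤0⇒n≡0 σ₁≤0)
  differentSlices⇒σ γ γ′ enc enc′ different | inj₂ ℓ≡1+m =
    inj₂ (ℓ≡1+m , differentSlices⇒σ≤ γ γ′ enc enc′ different 1 ℓ≡1+m)

  sameSlice-bound : 4 ≤ m → ∀ γ γ′ → γ ≢ γ′ → EncAt A i γ → EncAt A i γ′ →
    lookup γ i ≡ lookup γ′ i → m + m + σ i (not (lookup γ i)) A ≤ length A + σ i (lookup γ i) A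
  sameSlice-bound 4≤m γ γ′ γ≢γ′ enc enc′ same =
    σ-opposite-parities i A (encAt⇒sliceCount i odd γ enc) (subst₂ (λ b s → m ≤ sliceCount i b s A)
      (cong not (¬-not (encAt-χ-injective 4≤m γ γ′ γ≢γ′ enc enc′ ∘ sym))) (sym same)
      (encAt⇒sliceCount i odd γ′ enc′))

  sameSlice⇒σ : 4 ≤ m → (length A ≡ suc m → Separating A i) →
    ∀ γ γ′ → γ ≢ γ′ → EncAt A i γ → EncAt A i γ′ → lookup γ i ≡ lookup γ′ i →
    (length A ≡ m × σ i (lookup γ i) A ≡ m) ⊎ (length A ≡ suc m × m ≤ σ i (lookup γ i) A)
  sameSlice⇒σ 4≤m separating γ γ′ γ≢γ′ enc enc′ same with length-cases (encAt⇒m≤length γ enc)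
  ... | inj₁ ℓ≡m = inj₁ (ℓ≡m , ≤-antisym σ≤m
                          (cancel-doubled bound (≤-trans (≤-reflexive ℓ≡m) (m≤m+n m _))))
    where
    bound = sameSlice-bound 4≤m γ γ′ γ≢γ′ enc enc′ same
    σ≤m : σ i (lookup γ i) A ≤ m
    σ≤m = ≤-trans (σ≤sliceCount i true _ A) (≤-trans (sliceCount≤length i true _ A) (≤-reflexive ℓ≡m))
  ... | inj₂ ℓ≡1+m = inj₂ (ℓ≡1+m , cancel-doubled (sameSlice-bound 4≤m γ γ′ γ≢γ′ enc enc′ same)
      (≤-trans (≤-reflexive (trans ℓ≡1+m (+-comm 1 m)))
               (+-monoʳ-≤ m (separating⇒σ-positive i (separating ℓ≡1+m) (not (lookup γ i))))))

diminishable⇒length≤ : ∀ {n} {A : PairList n} → Diminishable A → length A ≤ n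
diminishable⇒length≤ (_ , inj₁ (|A|<n , _)) = <⇒≤ |A|<n
diminishable⇒length≤ (_ , inj₂ (|A|≡n , _)) = ≤-reflexive |A|≡n

lemma3p8 : (m : ℕ) → 4 < suc m → (A : PairList (suc m)) → Diminishable A →
    (i : Fin (suc m)) → (length A ≡ suc m → Separating A i) →
    (((length A ≡ m × σ i true A ≡ 0) ⊎ (length A ≡ suc m × σ i true A ≡ 1)) →
      (∃ λ γ → Enc (ρ i true (⋃ A)) γ) →
      (length A ≡ m × σ i false A ≡ 0) ⊎ (length A ≡ suc m × σ i false A ≤ 1))
    ×
    (∀ γ₁ γ₂ γ₃ → EncAt A i γ₁ → EncAt A i γ₂ → EncAt A i γ₃ →
      γ₁ ≡ γ₂ ⊎ γ₁ ≡ γ₃ ⊎ γ₂ ≡ γ₃)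
    ×
    (∀ γ γ′ → γ ≢ γ′ → EncAt A i γ → EncAt A i γ′ →
      m ≤ length A × χ γ ≢ χ γ′
      × (lookup γ i ≡ lookup γ′ i →
          (length A ≡ m × σ i (lookup γ i) A ≡ m)
          ⊎ (length A ≡ suc m × m ≤ σ i (lookup γ i) A))
      × (lookup γ i ≢ lookup γ′ i →
          (length A ≡ m × σ i false A ≡ 0 × σ i true A ≡ 0)
          ⊎ (length A ≡ suc m × σ i false A ≤ 1 × σ i true A ≤ 1)))
lemma3p8 m (s≤s 4≤m) A diminishable i separating =
  -- (1) needs only |A| ∈ {m, m + 1} from its hypothesis, not the value of n₁.
    (λ lengths (δ , enc) → encompassed⇒σ-opposite enc (Sum.map proj₁ proj₁ lengths))
  , encAt-atMostTwo 4≤m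
  , λ γ γ′ γ≢γ′ enc enc′ →
      encAt⇒m≤length γ enc , encAt-χ-injective 4≤m γ γ′ γ≢γ′ enc enc′
    , sameSlice⇒σ 4≤m separating γ γ′ γ≢γ′ enc enc′ , differentSlices⇒σ γ γ′ enc enc′
  where open Encompassed i (proj₂ (proj₁ diminishable)) (diminishable⇒length≤ diminishable)
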